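{- Let $G$ be a multigraph without loops, let $k=\min\{\delta(G)-1, \lfloor \rho_c(G) \rfloor \}$, and let $x\in V(G)$. Suppose $U$ is an optimal set of $G$ with $x\in U$ such that $|U|$ is minimum among the sizes of all optimal sets of $G$ containing $x$. Then for any optimal set $U'$ of $G$ with $U\not\subseteq U'$, we have $x\notin U\cap U'$.
   Context: Graphs may have multiple edges but no loops; $\delta(G)$ is the minimum degree. For $U\subseteq V(G)$, $e^+(U)$ is the number of edges of $G$ incident with at least one vertex of $U$. The co-density $\rho_c(G)$ is the minimum of $e^+(U)/((|U|+1)/2)$ over all $U\subseteq V(G)$ with $|U|$ odd and $|U|\ge 3$. A set $U\subseteq V(G)$ is odd if $|U|\ge 3$ and $|U|$ is odd; an odd set $U$ is optimal (with respect to $k$) if $e^+(U)=k(|U|+1)/2$. -}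

module Defs where

open import Data.Nat using (ℕ; suc; _+_; _*_; _≤_; _<_; _%_; _/_)
open import Data.Integer as ℤ using (ℤ; +_)
open import Data.Bool using (Bool; true; false; _∨_)
open import Data.Fin using (Fin)
open import Data.Fin.Subset using (Subset; ∣_∣)
open import Data.Vec using (lookup)
open import Data.List using (List; length; filterᵇ)
open import Data.Product using (_×_; proj₁; proj₂; ∃; _,_)
open import Relation.Binary.PropositionalEquality using (_≡_; _≢_)
open import Relation.Nullary.Decidable using (⌊_⌋)
open import Data.List.Relation.Unary.All using (All)

-- A finite multigraph without loops: vertex set Fin n, edge list of
-- (unordered) endpoint pairs; parallel edges allowed, loops forbidden.
record Multigraph : Set where
  field
    n        : ℕ
    edges    : List (Fin n × Fin n)
    loopless : All (λ e → proj₁ e ≢ proj₂ e) edges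
open Multigraph public

inB : ∀ {m} → Fin m → Subset m → Bool
inB v U = lookup U v

deg : (G : Multigraph) → Fin (n G) → ℕ
deg G v = length (filterᵇ (λ e → ⌊ proj₁ e Data.Fin.≟ v ⌋ ∨ ⌊ proj₂ e Data.Fin.≟ v ⌋) (edges G))

eplus : (G : Multigraph) → Subset (n G) → ℕ
eplus G U = length (filterᵇ (λ e → inB (proj₁ e) U ∨ inB (proj₂ e) U) (edges G))

IsMinDegree : (G : Multigraph) → ℕ → Set
IsMinDegree G d = (∀ v → d ≤ deg G v) × ∃ λ v → deg G v ≡ d

OddSet : ∀ {m} → Subset m → Set
OddSet U = (3 ≤ ∣ U ∣) × (∣ U ∣ % 2 ≡ 1)

-- r = ⌊ρ_c(G)⌋, where ρ_c(G) = min over odd U of e⁺(U)/((|U|+1)/2):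
-- r is the largest natural number with r ≤ e⁺(U)/((|U|+1)/2) for all odd U,
-- i.e. r·(|U|+1) ≤ 2·e⁺(U) for all odd U, and r+1 fails for some odd U.
IsFloorCoDensity : (G : Multigraph) → ℕ → Set
IsFloorCoDensity G r =
  (∀ (U : Subset (n G)) → OddSet U → r * (∣ U ∣ + 1) ≤ 2 * eplus G U)
  × ∃ λ (U : Subset (n G)) → OddSet U × (2 * eplus G U < suc r * (∣ U ∣ + 1))

Optimal : (G : Multigraph) → ℤ → Subset (n G) → Set
Optimal G k U = OddSet U × (+ eplus G U ≡ k ℤ.* + ((∣ U ∣ + 1) / 2))

-- If δ = 0 then k = −1 and no optimal set exists, so assume κ ≥ 0; then every
-- vertex has degree ≥ κ + 1 and κ (|S| + 1) ≤ 2 e⁺(S) for every S of odd size (for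
-- singletons by the degree bound). Suppose x lies in C = U ∩ U′.
-- If |C| is even, then U ∖ U′ and U′ ∖ U are odd, and counting every edge gives
-- e⁺(U ∖ U′) + e⁺(U′ ∖ U) + Σ_{v ∈ C} deg v ≤ e⁺(U) + e⁺(U′); the lower bounds make the
-- left side exceed the right side by |C| > 0.
-- If |C| is odd, so is U ∪ U′, and submodularity e⁺(U ∪ U′) + e⁺(C) ≤ e⁺(U) + e⁺(U′)
-- forces 2 e⁺(C) ≤ κ (|C| + 1). For |C| = 1 this contradicts the degree bound; for
-- |C| ≥ 3 it makes C an optimal set containing x, smaller than U since U ⊈ U′.
module Submission where

open import Defs
open import Algebra.Properties.CommutativeSemigroup using (interchange)
open import Data.Bool using (Bool; true; false; _∧_; _∨_; not)
open import Data.Bool.Properties using (∧-zeroʳ; ∧-identityʳ; ∨-zeroʳ)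
open import Data.Fin as Fin using (Fin; zero; suc)
open import Data.Fin.Subset
  using (Subset; inside; outside; _∈_; _∉_; _⊆_; _∩_; _∪_; _─_; ∣_∣; Nonempty)
open import Data.Fin.Subset.Properties using (∩-comm)
open import Data.Integer using (ℤ; +_; -[1+_]; _-_; _⊓_)
import Data.Integer.Properties as ℤ
open import Data.List using (List; []; _∷_; length; filterᵇ)
open import Data.Nat as ℕ
  using (ℕ; zero; suc; _+_; _*_; _≤_; _<_; z≤n; s≤s; _%_; _/_; parity)
open import Data.Nat.DivMod using (%-distribˡ-+; m/n*n≡m)
open import Data.Nat.Divisibility using (m%n≡0⇒n∣m)
open import Data.Nat.Properties
open import Data.Nat.Tactic.RingSolver using (solve-∀)
open import Data.Parity.Base as ℙ using (0ℙ; 1ℙ)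
import Data.Parity.Properties as ℙ
open import Data.Product using (_×_; _,_; proj₁; proj₂)
open import Data.Sum using (_⊎_; inj₁; inj₂; [_,_]′)
open import Data.Vec using ([]; _∷_; lookup; here; there; _[_]≔_)
open import Data.Vec.Properties using (lookup-zipWith; []=⇒lookup; lookup∘update; lookup∘update′)
open import Function using (_∘_)
open import Relation.Binary.PropositionalEquality
open import Relation.Nullary using (¬_; yes; no; contradiction)
open import Relation.Nullary.Decidable using (⌊_⌋)

𝟙 : Bool → ℕ
𝟙 true  = 1
𝟙 false = 0

𝟙-∨-≤ : ∀ a b → 𝟙 (a ∨ b) ≤ 𝟙 a + 𝟙 b
𝟙-∨-≤ true  b = s≤s z≤n
𝟙-∨-≤ false b = ≤-refl

∑ : {A : Set} → (A → ℕ) → List A → ℕ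
∑ f []       = 0
∑ f (x ∷ xs) = f x + ∑ f xs

length-filterᵇ : ∀ {A : Set} (p : A → Bool) xs → length (filterᵇ p xs) ≡ ∑ (𝟙 ∘ p) xs
length-filterᵇ p []       = refl
length-filterᵇ p (x ∷ xs) with p x
... | true  = cong suc (length-filterᵇ p xs)
... | false = length-filterᵇ p xs

∑-+ : ∀ {A : Set} (f g : A → ℕ) xs → ∑ (λ x → f x + g x) xs ≡ ∑ f xs + ∑ g xs
∑-+ f g []       = refl
∑-+ f g (x ∷ xs) = trans (cong (λ s → f x + g x + s) (∑-+ f g xs))
                         (interchange +-commutativeSemigroup (f x) (g x) (∑ f xs) (∑ g xs))

∑-mono-≤ : ∀ {A : Set} {f g : A → ℕ} → (∀ x → f x ≤ g x) → ∀ xs → ∑ f xs ≤ ∑ g xs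
∑-mono-≤ f≤g []       = z≤n
∑-mono-≤ f≤g (x ∷ xs) = +-mono-≤ (f≤g x) (∑-mono-≤ f≤g xs)

∑₂-mono-≤ : ∀ {A : Set} {f g h k : A → ℕ} → (∀ x → f x + g x ≤ h x + k x) →
            ∀ xs → ∑ f xs + ∑ g xs ≤ ∑ h xs + ∑ k xs
∑₂-mono-≤ {f = f} {g} {h} {k} le xs = begin
  ∑ f xs + ∑ g xs           ≡⟨ ∑-+ f g xs ⟨
  ∑ (λ x → f x + g x) xs   ≤⟨ ∑-mono-≤ le xs ⟩
  ∑ (λ x → h x + k x) xs   ≡⟨ ∑-+ h k xs ⟩
  ∑ h xs + ∑ k xs           ∎
  where open ≤-Reasoning

∣p∪q∣+∣p∩q∣≡∣p∣+∣q∣ : ∀ {m} (p q : Subset m) → ∣ p ∪ q ∣ + ∣ p ∩ q ∣ ≡ ∣ p ∣ + ∣ q ∣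
∣p∪q∣+∣p∩q∣≡∣p∣+∣q∣ []            []            = refl
∣p∪q∣+∣p∩q∣≡∣p∣+∣q∣ (inside ∷ p)  (inside ∷ q)  =
  cong suc (trans (+-suc _ _) (trans (cong suc (∣p∪q∣+∣p∩q∣≡∣p∣+∣q∣ p q)) (sym (+-suc _ _))))
∣p∪q∣+∣p∩q∣≡∣p∣+∣q∣ (inside ∷ p)  (outside ∷ q) = cong suc (∣p∪q∣+∣p∩q∣≡∣p∣+∣q∣ p q)
∣p∪q∣+∣p∩q∣≡∣p∣+∣q∣ (outside ∷ p) (inside ∷ q)  =
  trans (cong suc (∣p∪q∣+∣p∩q∣≡∣p∣+∣q∣ p q)) (sym (+-suc _ _))
∣p∪q∣+∣p∩q∣≡∣p∣+∣q∣ (outside ∷ p) (outside ∷ q) = ∣p∪q∣+∣p∩q∣≡∣p∣+∣q∣ p q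

∣p─q∣+∣p∩q∣≡∣p∣ : ∀ {m} (p q : Subset m) → ∣ p ─ q ∣ + ∣ p ∩ q ∣ ≡ ∣ p ∣
∣p─q∣+∣p∩q∣≡∣p∣ []            []            = refl
∣p─q∣+∣p∩q∣≡∣p∣ (inside ∷ p)  (inside ∷ q)  = trans (+-suc _ _) (cong suc (∣p─q∣+∣p∩q∣≡∣p∣ p q))
∣p─q∣+∣p∩q∣≡∣p∣ (inside ∷ p)  (outside ∷ q) = cong suc (∣p─q∣+∣p∩q∣≡∣p∣ p q)
∣p─q∣+∣p∩q∣≡∣p∣ (outside ∷ p) (inside ∷ q)  = ∣p─q∣+∣p∩q∣≡∣p∣ p q
∣p─q∣+∣p∩q∣≡∣p∣ (outside ∷ p) (outside ∷ q) = ∣p─q∣+∣p∩q∣≡∣p∣ p q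

∣p─q∣≡0⇒p⊆q : ∀ {m} (p q : Subset m) → ∣ p ─ q ∣ ≡ 0 → p ⊆ q
∣p─q∣≡0⇒p⊆q (inside ∷ p)  (inside ∷ q)  _  here        = here
∣p─q∣≡0⇒p⊆q (inside ∷ p)  (inside ∷ q)  eq (there x∈p) = there (∣p─q∣≡0⇒p⊆q p q eq x∈p)
∣p─q∣≡0⇒p⊆q (outside ∷ p) (inside ∷ q)  eq (there x∈p) = there (∣p─q∣≡0⇒p⊆q p q eq x∈p)
∣p─q∣≡0⇒p⊆q (outside ∷ p) (outside ∷ q) eq (there x∈p) = there (∣p─q∣≡0⇒p⊆q p q eq x∈p)

p⊈q⇒∣p∩q∣<∣p∣ : ∀ {m} (p q : Subset m) → ¬ p ⊆ q → ∣ p ∩ q ∣ < ∣ p ∣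
p⊈q⇒∣p∩q∣<∣p∣ p q p⊈q = subst (∣ p ∩ q ∣ <_) (∣p─q∣+∣p∩q∣≡∣p∣ p q)
  (m<n+m ∣ p ∩ q ∣ (n≢0⇒n>0 (p⊈q ∘ ∣p─q∣≡0⇒p⊆q p q)))

∣p∣≡1+n⇒Nonempty : ∀ {m c} (p : Subset m) → ∣ p ∣ ≡ suc c → Nonempty p
∣p∣≡1+n⇒Nonempty (inside ∷ p)  _  = zero , here
∣p∣≡1+n⇒Nonempty (outside ∷ p) eq with ∣p∣≡1+n⇒Nonempty p eq
... | x , x∈p = suc x , there x∈p

x∈p⇒∣p∣≡1+∣p[x]≔outside∣ : ∀ {m} {x : Fin m} {p : Subset m} → x ∈ p →
                           ∣ p ∣ ≡ suc ∣ p [ x ]≔ outside ∣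
x∈p⇒∣p∣≡1+∣p[x]≔outside∣                        here        = refl
x∈p⇒∣p∣≡1+∣p[x]≔outside∣ {p = inside ∷ p}  (there x∈p) = cong suc (x∈p⇒∣p∣≡1+∣p[x]≔outside∣ x∈p)
x∈p⇒∣p∣≡1+∣p[x]≔outside∣ {p = outside ∷ p} (there x∈p) = x∈p⇒∣p∣≡1+∣p[x]≔outside∣ x∈p

lookup-─ : ∀ {m} (p q : Subset m) i → lookup (p ─ q) i ≡ lookup p i ∧ not (lookup q i)
lookup-─ (s ∷ p) (inside ∷ q)  zero    = sym (∧-zeroʳ s)
lookup-─ (s ∷ p) (outside ∷ q) zero    = sym (∧-identityʳ s)
lookup-─ (_ ∷ p) (_ ∷ q)       (suc i) = lookup-─ p q i

𝟙-lookup-[x]≔outside : ∀ {m} {x : Fin m} {p : Subset m} → x ∈ p →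
  ∀ y → 𝟙 ⌊ y Fin.≟ x ⌋ + 𝟙 (lookup (p [ x ]≔ outside) y) ≡ 𝟙 (lookup p y)
𝟙-lookup-[x]≔outside {x = x} {p} x∈p y with y Fin.≟ x
... | yes refl rewrite lookup∘update x p outside | []=⇒lookup x∈p = refl
... | no y≢x  = cong 𝟙 (lookup∘update′ y≢x p outside)

𝟙-submodular : ∀ a b c d →
  𝟙 ((a ∨ c) ∨ (b ∨ d)) + 𝟙 ((a ∧ c) ∨ (b ∧ d)) ≤ 𝟙 (a ∨ b) + 𝟙 (c ∨ d)
𝟙-submodular true  true  true  true  = ≤ᵇ⇒≤ _ _ _
𝟙-submodular true  true  true  false = ≤ᵇ⇒≤ _ _ _
𝟙-submodular true  true  false true  = ≤ᵇ⇒≤ _ _ _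
𝟙-submodular true  true  false false = ≤ᵇ⇒≤ _ _ _
𝟙-submodular true  false true  true  = ≤ᵇ⇒≤ _ _ _
𝟙-submodular true  false true  false = ≤ᵇ⇒≤ _ _ _
𝟙-submodular true  false false true  = ≤ᵇ⇒≤ _ _ _
𝟙-submodular true  false false false = ≤ᵇ⇒≤ _ _ _
𝟙-submodular false true  true  true  = ≤ᵇ⇒≤ _ _ _
𝟙-submodular false true  true  false = ≤ᵇ⇒≤ _ _ _
𝟙-submodular false true  false true  = ≤ᵇ⇒≤ _ _ _
𝟙-submodular false true  false false = ≤ᵇ⇒≤ _ _ _
𝟙-submodular false false true  true  = ≤ᵇ⇒≤ _ _ _
𝟙-submodular false false true  false = ≤ᵇ⇒≤ _ _ _
𝟙-submodular false false false true  = ≤ᵇ⇒≤ _ _ _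
𝟙-submodular false false false false = ≤ᵇ⇒≤ _ _ _

𝟙-differences-≤ : ∀ a b c d →
  𝟙 ((a ∧ not c) ∨ (b ∧ not d)) + 𝟙 ((c ∧ not a) ∨ (d ∧ not b)) + (𝟙 (a ∧ c) + 𝟙 (b ∧ d))
    ≤ 𝟙 (a ∨ b) + 𝟙 (c ∨ d)
𝟙-differences-≤ true  true  true  true  = ≤ᵇ⇒≤ _ _ _
𝟙-differences-≤ true  true  true  false = ≤ᵇ⇒≤ _ _ _
𝟙-differences-≤ true  true  false true  = ≤ᵇ⇒≤ _ _ _
𝟙-differences-≤ true  true  false false = ≤ᵇ⇒≤ _ _ _
𝟙-differences-≤ true  false true  true  = ≤ᵇ⇒≤ _ _ _
𝟙-differences-≤ true  false true  false = ≤ᵇ⇒≤ _ _ _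
𝟙-differences-≤ true  false false true  = ≤ᵇ⇒≤ _ _ _
𝟙-differences-≤ true  false false false = ≤ᵇ⇒≤ _ _ _
𝟙-differences-≤ false true  true  true  = ≤ᵇ⇒≤ _ _ _
𝟙-differences-≤ false true  true  false = ≤ᵇ⇒≤ _ _ _
𝟙-differences-≤ false true  false true  = ≤ᵇ⇒≤ _ _ _
𝟙-differences-≤ false true  false false = ≤ᵇ⇒≤ _ _ _
𝟙-differences-≤ false false true  true  = ≤ᵇ⇒≤ _ _ _
𝟙-differences-≤ false false true  false = ≤ᵇ⇒≤ _ _ _
𝟙-differences-≤ false false false true  = ≤ᵇ⇒≤ _ _ _
𝟙-differences-≤ false false false false = ≤ᵇ⇒≤ _ _ _

module _ (G : Multigraph) where

  Edge : Set
  Edge = Fin (n G) × Fin (n G)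

  hits : Subset (n G) → Edge → Bool
  hits X e = lookup X (proj₁ e) ∨ lookup X (proj₂ e)

  incident : Fin (n G) → Edge → Bool
  incident v e = ⌊ proj₁ e Fin.≟ v ⌋ ∨ ⌊ proj₂ e Fin.≟ v ⌋

  endsIn : Subset (n G) → Edge → ℕ
  endsIn X e = 𝟙 (lookup X (proj₁ e)) + 𝟙 (lookup X (proj₂ e))

  -- Σ_{v ∈ X} deg v, counted edge by edge (a loop would count twice here, once in deg).
  endpoints : Subset (n G) → ℕ
  endpoints X = ∑ (endsIn X) (edges G)

  eplus≡∑ : ∀ X → eplus G X ≡ ∑ (𝟙 ∘ hits X) (edges G)
  eplus≡∑ X = length-filterᵇ (hits X) (edges G)

  deg≡∑ : ∀ v → deg G v ≡ ∑ (𝟙 ∘ incident v) (edges G)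
  deg≡∑ v = length-filterᵇ (incident v) (edges G)

  ∑₂-≤-eplus+eplus : ∀ {f g : Edge → ℕ} U V → (∀ e → f e + g e ≤ 𝟙 (hits U e) + 𝟙 (hits V e)) →
                     ∑ f (edges G) + ∑ g (edges G) ≤ eplus G U + eplus G V
  ∑₂-≤-eplus+eplus {f} {g} U V le = begin
    ∑ f (edges G) + ∑ g (edges G)                       ≤⟨ ∑₂-mono-≤ le (edges G) ⟩
    ∑ (𝟙 ∘ hits U) (edges G) + ∑ (𝟙 ∘ hits V) (edges G) ≡⟨ cong₂ _+_ (eplus≡∑ U) (eplus≡∑ V) ⟨
    eplus G U + eplus G V                              ∎
    where open ≤-Reasoning

  eplus-submodular : ∀ U V → eplus G (U ∪ V) + eplus G (U ∩ V) ≤ eplus G U + eplus G V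
  eplus-submodular U V =
    subst (_≤ eplus G U + eplus G V) (sym (cong₂ _+_ (eplus≡∑ (U ∪ V)) (eplus≡∑ (U ∩ V))))
      (∑₂-≤-eplus+eplus U V per-edge)
    where
    per-edge : ∀ e → 𝟙 (hits (U ∪ V) e) + 𝟙 (hits (U ∩ V) e) ≤ 𝟙 (hits U e) + 𝟙 (hits V e)
    per-edge (p , q)
      rewrite lookup-zipWith _∨_ p U V | lookup-zipWith _∨_ q U V
            | lookup-zipWith _∧_ p U V | lookup-zipWith _∧_ q U V
      = 𝟙-submodular (lookup U p) (lookup U q) (lookup V p) (lookup V q)

  eplus-differences-≤ : ∀ U V →
    eplus G (U ─ V) + eplus G (V ─ U) + endpoints (U ∩ V) ≤ eplus G U + eplus G V
  eplus-differences-≤ U V =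
    subst (_≤ eplus G U + eplus G V) (sym lhs≡∑) (∑₂-≤-eplus+eplus U V per-edge)
    where
    lhs≡∑ : eplus G (U ─ V) + eplus G (V ─ U) + endpoints (U ∩ V)
          ≡ ∑ (λ e → 𝟙 (hits (U ─ V) e) + 𝟙 (hits (V ─ U) e)) (edges G) + endpoints (U ∩ V)
    lhs≡∑ = cong (_+ endpoints (U ∩ V))
      (trans (cong₂ _+_ (eplus≡∑ (U ─ V)) (eplus≡∑ (V ─ U)))
             (sym (∑-+ (𝟙 ∘ hits (U ─ V)) (𝟙 ∘ hits (V ─ U)) (edges G))))
    per-edge : ∀ e → 𝟙 (hits (U ─ V) e) + 𝟙 (hits (V ─ U) e) + endsIn (U ∩ V) e
                     ≤ 𝟙 (hits U e) + 𝟙 (hits V e)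
    per-edge (p , q)
      rewrite lookup-─ U V p | lookup-─ U V q | lookup-─ V U p | lookup-─ V U q
            | lookup-zipWith _∧_ p U V | lookup-zipWith _∧_ q U V
      = 𝟙-differences-≤ (lookup U p) (lookup U q) (lookup V p) (lookup V q)

  deg≤eplus : ∀ {v S} → v ∈ S → deg G v ≤ eplus G S
  deg≤eplus {v} {S} v∈S = begin
    deg G v                      ≡⟨ deg≡∑ v ⟩
    ∑ (𝟙 ∘ incident v) (edges G) ≤⟨ ∑-mono-≤ per-edge (edges G) ⟩
    ∑ (𝟙 ∘ hits S) (edges G)     ≡⟨ eplus≡∑ S ⟨
    eplus G S                    ∎
    where
    open ≤-Reasoning
    per-edge : ∀ e → 𝟙 (incident v e) ≤ 𝟙 (hits S e)
    per-edge (p , q) with p Fin.≟ v | q Fin.≟ v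
    ... | yes refl | _     rewrite []=⇒lookup v∈S = ≤-refl
    ... | no _     | yes refl rewrite []=⇒lookup v∈S | ∨-zeroʳ (lookup S p) = ≤-refl
    ... | no _     | no _  = z≤n

  ∣X∣*d≤endpoints : ∀ {d} → (∀ v → d ≤ deg G v) → ∀ X → ∣ X ∣ * d ≤ endpoints X
  ∣X∣*d≤endpoints {d} d≤deg X = go ∣ X ∣ X refl
    where
    go : ∀ c X → ∣ X ∣ ≡ c → c * d ≤ endpoints X
    go zero    X _  = z≤n
    go (suc c) X eq with ∣p∣≡1+n⇒Nonempty X eq
    ... | v , v∈X = begin
      d + c * d                                      ≤⟨ +-mono-≤ (d≤deg v) (go c X′ ∣X′∣≡c) ⟩
      deg G v + endpoints X′                        ≡⟨ cong (_+ endpoints X′) (deg≡∑ v) ⟩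
      ∑ (𝟙 ∘ incident v) (edges G) + endpoints X′  ≡⟨ ∑-+ (𝟙 ∘ incident v) (endsIn X′) (edges G) ⟨
      ∑ (λ e → 𝟙 (incident v e) + endsIn X′ e) (edges G) ≤⟨ ∑-mono-≤ per-edge (edges G) ⟩
      endpoints X                                    ∎
      where
      open ≤-Reasoning
      X′ = X [ v ]≔ outside
      ∣X′∣≡c : ∣ X′ ∣ ≡ c
      ∣X′∣≡c = suc-injective (trans (sym (x∈p⇒∣p∣≡1+∣p[x]≔outside∣ v∈X)) eq)
      per-edge : ∀ e → 𝟙 (incident v e) + endsIn X′ e ≤ endsIn X e
      per-edge (p , q) = begin
        𝟙 (incident v (p , q)) + endsIn X′ (p , q)
          ≤⟨ +-monoˡ-≤ _ (𝟙-∨-≤ ⌊ p Fin.≟ v ⌋ ⌊ q Fin.≟ v ⌋) ⟩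
        (𝟙 ⌊ p Fin.≟ v ⌋ + 𝟙 ⌊ q Fin.≟ v ⌋) + endsIn X′ (p , q)
          ≡⟨ interchange +-commutativeSemigroup (𝟙 ⌊ p Fin.≟ v ⌋) _ _ (𝟙 (lookup X′ q)) ⟩
        (𝟙 ⌊ p Fin.≟ v ⌋ + 𝟙 (lookup X′ p)) + (𝟙 ⌊ q Fin.≟ v ⌋ + 𝟙 (lookup X′ q))
          ≡⟨ cong₂ _+_ (𝟙-lookup-[x]≔outside v∈X p) (𝟙-lookup-[x]≔outside v∈X q) ⟩
        endsIn X (p , q) ∎

%2≡1⇒parity≡1ℙ : ∀ m → m % 2 ≡ 1 → parity m ≡ 1ℙ
%2≡1⇒parity≡1ℙ 1             _   = refl
%2≡1⇒parity≡1ℙ (suc (suc m)) odd = %2≡1⇒parity≡1ℙ m odd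

parity≡1ℙ⇒%2≡1 : ∀ m → parity m ≡ 1ℙ → m % 2 ≡ 1
parity≡1ℙ⇒%2≡1 1             _   = refl
parity≡1ℙ⇒%2≡1 (suc (suc m)) odd = parity≡1ℙ⇒%2≡1 m odd

%2≢1⇒parity≡0ℙ : ∀ m → m % 2 ≢ 1 → parity m ≡ 0ℙ
%2≢1⇒parity≡0ℙ m ¬odd with parity m in eq
... | 0ℙ = refl
... | 1ℙ = contradiction (parity≡1ℙ⇒%2≡1 m eq) ¬odd

parity-cancelʳ : ∀ m n {w} → m + n ≡ w → parity m ≡ parity w ℙ.+ parity n
parity-cancelʳ m n refl = sym (begin
  parity (m + n) ℙ.+ parity n          ≡⟨ cong (ℙ._+ parity n) (ℙ.+-homo-+ m n) ⟩
  parity m ℙ.+ parity n ℙ.+ parity n   ≡⟨ ℙ.+-assoc (parity m) (parity n) (parity n) ⟩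
  parity m ℙ.+ (parity n ℙ.+ parity n) ≡⟨ cong (parity m ℙ.+_) (ℙ.p+p≡0ℙ (parity n)) ⟩
  parity m ℙ.+ 0ℙ                      ≡⟨ ℙ.+-identityʳ (parity m) ⟩
  parity m                             ∎)
  where open ≡-Reasoning

∣p∪q∣-odd : ∀ {m} (p q : Subset m) → ∣ p ∣ % 2 ≡ 1 → ∣ q ∣ % 2 ≡ 1 → ∣ p ∩ q ∣ % 2 ≡ 1 →
            ∣ p ∪ q ∣ % 2 ≡ 1
∣p∪q∣-odd p q p-odd q-odd p∩q-odd = parity≡1ℙ⇒%2≡1 ∣ p ∪ q ∣ (begin
  parity ∣ p ∪ q ∣
    ≡⟨ parity-cancelʳ ∣ p ∪ q ∣ ∣ p ∩ q ∣ (∣p∪q∣+∣p∩q∣≡∣p∣+∣q∣ p q) ⟩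
  parity (∣ p ∣ + ∣ q ∣) ℙ.+ parity ∣ p ∩ q ∣
    ≡⟨ cong (ℙ._+ parity ∣ p ∩ q ∣) (ℙ.+-homo-+ ∣ p ∣ ∣ q ∣) ⟩
  parity ∣ p ∣ ℙ.+ parity ∣ q ∣ ℙ.+ parity ∣ p ∩ q ∣
    ≡⟨ cong₂ ℙ._+_ (cong₂ ℙ._+_ (%2≡1⇒parity≡1ℙ ∣ p ∣ p-odd) (%2≡1⇒parity≡1ℙ ∣ q ∣ q-odd))
                   (%2≡1⇒parity≡1ℙ ∣ p ∩ q ∣ p∩q-odd) ⟩
  1ℙ ∎)
  where open ≡-Reasoning

∣p─q∣-odd : ∀ {m} (p q : Subset m) → ∣ p ∣ % 2 ≡ 1 → ∣ p ∩ q ∣ % 2 ≢ 1 → ∣ p ─ q ∣ % 2 ≡ 1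
∣p─q∣-odd p q p-odd p∩q-even = parity≡1ℙ⇒%2≡1 ∣ p ─ q ∣ (begin
  parity ∣ p ─ q ∣
    ≡⟨ parity-cancelʳ ∣ p ─ q ∣ ∣ p ∩ q ∣ (∣p─q∣+∣p∩q∣≡∣p∣ p q) ⟩
  parity ∣ p ∣ ℙ.+ parity ∣ p ∩ q ∣
    ≡⟨ cong₂ ℙ._+_ (%2≡1⇒parity≡1ℙ ∣ p ∣ p-odd) (%2≢1⇒parity≡0ℙ ∣ p ∩ q ∣ p∩q-even) ⟩
  1ℙ ∎)
  where open ≡-Reasoning

odd⇒≡1⊎3≤ : ∀ m → m % 2 ≡ 1 → m ≡ 1 ⊎ 3 ≤ m
odd⇒≡1⊎3≤ 1                   _ = inj₁ refl
odd⇒≡1⊎3≤ (suc (suc (suc m))) _ = inj₂ (s≤s (s≤s (s≤s z≤n)))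

[m+1]/2*2≡m+1 : ∀ m → m % 2 ≡ 1 → (m + 1) / 2 * 2 ≡ m + 1
[m+1]/2*2≡m+1 m odd = m/n*n≡m (m%n≡0⇒n∣m (m + 1) 2 (begin
  (m + 1) % 2     ≡⟨ %-distribˡ-+ m 1 2 ⟩
  (m % 2 + 1) % 2 ≡⟨ cong (λ r → (r + 1) % 2) odd ⟩
  0               ∎))
  where open ≡-Reasoning

module _ (G : Multigraph) (κ : ℕ) (U : Subset (n G)) where

  private
    h = (∣ U ∣ + 1) / 2

    2[κh]≡κ[h2] : ∀ κ h → 2 * (κ * h) ≡ κ * (h * 2)
    2[κh]≡κ[h2] = solve-∀

  optimal⇒2e≡κ[∣U∣+1] : Optimal G (+ κ) U → 2 * eplus G U ≡ κ * (∣ U ∣ + 1)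
  optimal⇒2e≡κ[∣U∣+1] ((_ , odd) , e≡κh) = begin
    2 * eplus G U   ≡⟨ cong (2 *_) (ℤ.+-injective (trans e≡κh (sym (ℤ.pos-* κ h)))) ⟩
    2 * (κ * h)     ≡⟨ 2[κh]≡κ[h2] κ h ⟩
    κ * (h * 2)     ≡⟨ cong (κ *_) ([m+1]/2*2≡m+1 ∣ U ∣ odd) ⟩
    κ * (∣ U ∣ + 1) ∎
    where open ≡-Reasoning

  2e≡κ[∣U∣+1]⇒optimal : OddSet U → 2 * eplus G U ≡ κ * (∣ U ∣ + 1) → Optimal G (+ κ) U
  2e≡κ[∣U∣+1]⇒optimal oddU@(_ , odd) 2e≡ = oddU , trans (cong +_ e≡κh) (ℤ.pos-* κ h)
    where
    open ≡-Reasoning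
    e≡κh : eplus G U ≡ κ * h
    e≡κh = *-cancelˡ-≡ _ _ 2 (begin
      2 * eplus G U   ≡⟨ 2e≡ ⟩
      κ * (∣ U ∣ + 1) ≡⟨ cong (κ *_) ([m+1]/2*2≡m+1 ∣ U ∣ odd) ⟨
      κ * (h * 2)     ≡⟨ 2[κh]≡κ[h2] κ h ⟨
      2 * (κ * h)     ∎)

optimal₂⇒2[e+e]≡ : ∀ G κ U U′ → Optimal G (+ κ) U → Optimal G (+ κ) U′ →
                   2 * (eplus G U + eplus G U′) ≡ κ * (∣ U ∣ + 1) + κ * (∣ U′ ∣ + 1)
optimal₂⇒2[e+e]≡ G κ U U′ oU oU′ =
  trans (*-distribˡ-+ 2 (eplus G U) (eplus G U′))
        (cong₂ _+_ (optimal⇒2e≡κ[∣U∣+1] G κ U oU) (optimal⇒2e≡κ[∣U∣+1] G κ U′ oU′))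

¬Optimal[-1] : ∀ G U → ¬ Optimal G -[1+ 0 ] U
¬Optimal[-1] G U ((_ , odd) , eq) with (∣ U ∣ + 1) / 2 | [m+1]/2*2≡m+1 ∣ U ∣ odd
... | zero  | 0≡∣U∣+1 = 0≢1+n (trans 0≡∣U∣+1 (+-comm ∣ U ∣ 1))
... | suc _ | _       with eq
...   | ()

k[m+1]+k[n+1]-cong : ∀ k {m n m′ n′} → m + n ≡ m′ + n′ →
                     k * (m + 1) + k * (n + 1) ≡ k * (m′ + 1) + k * (n′ + 1)
k[m+1]+k[n+1]-cong k {m} {n} {m′} {n′} eq = begin
  k * (m + 1) + k * (n + 1)   ≡⟨ expand k m n ⟩
  k * (m + n + 2)             ≡⟨ cong (λ s → k * (s + 2)) eq ⟩
  k * (m′ + n′ + 2)           ≡⟨ expand k m′ n′ ⟨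
  k * (m′ + 1) + k * (n′ + 1) ∎
  where
  open ≡-Reasoning
  expand : ∀ k m n → k * (m + 1) + k * (n + 1) ≡ k * (m + n + 2)
  expand = solve-∀

module _ (G : Multigraph) (κ : ℕ)
  (κ<deg : ∀ v → suc κ ≤ deg G v)
  (κ≤density : ∀ S → OddSet S → κ * (∣ S ∣ + 1) ≤ 2 * eplus G S)
  where

  κ<eplus : ∀ {v S} → v ∈ S → suc κ ≤ eplus G S
  κ<eplus v∈S = ≤-trans (κ<deg _) (deg≤eplus G v∈S)

  odd⇒κ≤density : ∀ S → ∣ S ∣ % 2 ≡ 1 → κ * (∣ S ∣ + 1) ≤ 2 * eplus G S
  odd⇒κ≤density S odd with odd⇒≡1⊎3≤ ∣ S ∣ odd
  ... | inj₂ 3≤∣S∣ = κ≤density S (3≤∣S∣ , odd)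
  ... | inj₁ ∣S∣≡1 with ∣p∣≡1+n⇒Nonempty S ∣S∣≡1
  ...   | _ , v∈S rewrite ∣S∣≡1 = begin
    κ * 2         ≡⟨ *-comm κ 2 ⟩
    2 * κ         ≤⟨ *-monoʳ-≤ 2 (≤-trans (n≤1+n κ) (κ<eplus v∈S)) ⟩
    2 * eplus G S ∎
    where open ≤-Reasoning

  ∩-tight : ∀ U U′ → Optimal G (+ κ) U → Optimal G (+ κ) U′ → ∣ U ∩ U′ ∣ % 2 ≡ 1 →
            2 * eplus G (U ∩ U′) ≤ κ * (∣ U ∩ U′ ∣ + 1)
  ∩-tight U U′ oU@((_ , u-odd) , _) oU′@((_ , u′-odd) , _) c-odd =
    +-cancelˡ-≤ (2 * eplus G (U ∪ U′)) _ _ (begin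
      2 * eplus G (U ∪ U′) + 2 * eplus G (U ∩ U′)
        ≡⟨ *-distribˡ-+ 2 (eplus G (U ∪ U′)) _ ⟨
      2 * (eplus G (U ∪ U′) + eplus G (U ∩ U′))
        ≤⟨ *-monoʳ-≤ 2 (eplus-submodular G U U′) ⟩
      2 * (eplus G U + eplus G U′)
        ≡⟨ optimal₂⇒2[e+e]≡ G κ U U′ oU oU′ ⟩
      κ * (∣ U ∣ + 1) + κ * (∣ U′ ∣ + 1)
        ≡⟨ k[m+1]+k[n+1]-cong κ (sym (∣p∪q∣+∣p∩q∣≡∣p∣+∣q∣ U U′)) ⟩
      κ * (∣ U ∪ U′ ∣ + 1) + κ * (∣ U ∩ U′ ∣ + 1)
        ≤⟨ +-monoˡ-≤ _ (odd⇒κ≤density (U ∪ U′) (∣p∪q∣-odd U U′ u-odd u′-odd c-odd)) ⟩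
      2 * eplus G (U ∪ U′) + κ * (∣ U ∩ U′ ∣ + 1) ∎)
    where open ≤-Reasoning

  ∩-even⇒∣∩∣≡0 : ∀ U U′ → Optimal G (+ κ) U → Optimal G (+ κ) U′ →
                 ∣ U ∩ U′ ∣ % 2 ≢ 1 → ∣ U ∩ U′ ∣ ≡ 0
  ∩-even⇒∣∩∣≡0 U U′ oU@((_ , u-odd) , _) oU′@((_ , u′-odd) , _) c-even =
    m*n≡0⇒m≡0 c 2 (n≤0⇒n≡0 (+-cancelˡ-≤ K (c * 2) 0 (begin
      K + c * 2
        ≡⟨ add-c-copies κ a b c ⟩
      κ * (a + 1) + κ * (b + 1) + 2 * (c * suc κ)
        ≤⟨ +-mono-≤ (+-mono-≤ (odd⇒κ≤density (U ─ U′) a-odd) (odd⇒κ≤density (U′ ─ U) b-odd))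
                    (*-monoʳ-≤ 2 (∣X∣*d≤endpoints G κ<deg (U ∩ U′))) ⟩
      2 * eplus G (U ─ U′) + 2 * eplus G (U′ ─ U) + 2 * endpoints G (U ∩ U′)
        ≡⟨ 2*-distrib₃ (eplus G (U ─ U′)) (eplus G (U′ ─ U)) _ ⟩
      2 * (eplus G (U ─ U′) + eplus G (U′ ─ U) + endpoints G (U ∩ U′))
        ≤⟨ *-monoʳ-≤ 2 (eplus-differences-≤ G U U′) ⟩
      2 * (eplus G U + eplus G U′)
        ≡⟨ optimal₂⇒2[e+e]≡ G κ U U′ oU oU′ ⟩
      κ * (∣ U ∣ + 1) + κ * (∣ U′ ∣ + 1)
        ≡⟨ cong₂ (λ s t → κ * (s + 1) + κ * (t + 1)) (∣p─q∣+∣p∩q∣≡∣p∣ U U′) ∣U′─U∣+c≡∣U′∣ ⟨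
      κ * (a + c + 1) + κ * (b + c + 1)
        ≡⟨ split-c κ a b c ⟩
      K + 0 ∎)))
    where
    open ≤-Reasoning
    c = ∣ U ∩ U′ ∣
    a = ∣ U ─ U′ ∣
    b = ∣ U′ ─ U ∣
    K = κ * (a + 1) + κ * (b + 1) + 2 * (c * κ)
    ∣U′─U∣+c≡∣U′∣ : b + c ≡ ∣ U′ ∣
    ∣U′─U∣+c≡∣U′∣ = subst (λ C → b + ∣ C ∣ ≡ ∣ U′ ∣) (∩-comm U′ U) (∣p─q∣+∣p∩q∣≡∣p∣ U′ U)
    a-odd : a % 2 ≡ 1
    a-odd = ∣p─q∣-odd U U′ u-odd c-even
    b-odd : b % 2 ≡ 1
    b-odd = ∣p─q∣-odd U′ U u′-odd (subst (λ C → ∣ C ∣ % 2 ≢ 1) (∩-comm U U′) c-even)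
    add-c-copies : ∀ k a b c →
      k * (a + 1) + k * (b + 1) + 2 * (c * k) + c * 2 ≡ k * (a + 1) + k * (b + 1) + 2 * (c * suc k)
    add-c-copies = solve-∀
    2*-distrib₃ : ∀ x y z → 2 * x + 2 * y + 2 * z ≡ 2 * (x + y + z)
    2*-distrib₃ = solve-∀
    split-c : ∀ k a b c →
      k * (a + c + 1) + k * (b + c + 1) ≡ k * (a + 1) + k * (b + 1) + 2 * (c * k) + 0
    split-c = solve-∀

  ∩-odd : ∀ {x} U U′ → Optimal G (+ κ) U → Optimal G (+ κ) U′ → x ∈ U ∩ U′ →
          ∣ U ∩ U′ ∣ % 2 ≡ 1
  ∩-odd U U′ oU oU′ x∈C with ∣ U ∩ U′ ∣ % 2 ℕ.≟ 1
  ... | yes c-odd  = c-odd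
  ... | no  c-even = contradiction
    (trans (sym (x∈p⇒∣p∣≡1+∣p[x]≔outside∣ x∈C)) (∩-even⇒∣∩∣≡0 U U′ oU oU′ c-even)) 1+n≢0

  minimal-optimal-∩ : ∀ x U → Optimal G (+ κ) U →
    (∀ W → Optimal G (+ κ) W → x ∈ W → ∣ U ∣ ≤ ∣ W ∣) →
    ∀ U′ → Optimal G (+ κ) U′ → ¬ U ⊆ U′ → x ∉ U ∩ U′
  minimal-optimal-∩ x U oU minimal U′ oU′ U⊈U′ x∈C =
    [ ∣C∣≢1 , ∣C∣≱3 ]′ (odd⇒≡1⊎3≤ ∣ U ∩ U′ ∣ c-odd)
    where
    c-odd : ∣ U ∩ U′ ∣ % 2 ≡ 1
    c-odd = ∩-odd U U′ oU oU′ x∈C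
    ∣C∣≢1 : ∣ U ∩ U′ ∣ ≢ 1
    ∣C∣≢1 ∣C∣≡1 = <⇒≱ (*-monoʳ-< 2 (κ<eplus x∈C)) (begin
      2 * eplus G (U ∩ U′) ≤⟨ ∩-tight U U′ oU oU′ c-odd ⟩
      κ * (∣ U ∩ U′ ∣ + 1) ≡⟨ cong (λ s → κ * (s + 1)) ∣C∣≡1 ⟩
      κ * 2                ≡⟨ *-comm κ 2 ⟩
      2 * κ                ∎)
      where open ≤-Reasoning
    ∣C∣≱3 : ¬ 3 ≤ ∣ U ∩ U′ ∣
    ∣C∣≱3 3≤∣C∣ = <⇒≱ (p⊈q⇒∣p∩q∣<∣p∣ U U′ U⊈U′) (minimal (U ∩ U′) C-optimal x∈C)
      where
      C-optimal : Optimal G (+ κ) (U ∩ U′)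
      C-optimal = 2e≡κ[∣U∣+1]⇒optimal G κ (U ∩ U′) (3≤∣C∣ , c-odd)
        (≤-antisym (∩-tight U U′ oU oU′ c-odd) (κ≤density (U ∩ U′) (3≤∣C∣ , c-odd)))

lemma2p4 : (G : Multigraph) (δ r : ℕ) (k : ℤ) → IsMinDegree G δ → IsFloorCoDensity G r
    → k ≡ (+ δ - + 1) ⊓ + r
    → (x : Fin (n G)) (U : Subset (n G)) → Optimal G k U → x ∈ U
    → (∀ (W : Subset (n G)) → Optimal G k W → x ∈ W → ∣ U ∣ ≤ ∣ W ∣)
    → ∀ (U′ : Subset (n G)) → Optimal G k U′ → ¬ (U ⊆ U′) → x ∉ U ∩ U′
lemma2p4 G zero    r _ _               _                refl x U oU _ _ _ _ _ =
  contradiction oU (¬Optimal[-1] G U)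
lemma2p4 G (suc d) r _ (δ≤deg , _) (r≤density , _) refl x U oU _ =
  minimal-optimal-∩ G (d ℕ.⊓ r)
    (λ v → ≤-trans (s≤s (m⊓n≤m d r)) (δ≤deg v))
    (λ S odd-S → ≤-trans (*-monoˡ-≤ (∣ S ∣ + 1) (m⊓n≤n d r)) (r≤density S odd-S))
    x U oU
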